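{- Let $m\ge 1$ and let $T=\{1-12,\,2-21\}$. For integers $n\ge 0$ and $k\ge 0$ let $\alpha_{n,k}$ be the number of words of length $n$ on $\{1,\dots,m\}$ that avoid both $1-12$ and $2-21$ and whose set of letters is exactly $\{1,\dots,k\}$. Then for $k\le m$ (and $0\le k\le n$), \[ \alpha_{n,k}=\begin{cases} k\cdot k!, & k<n,\\ n!, & k=n,\end{cases} \] whereas for $k>m$ one has $\alpha_{n,k}=0$.
   Context: A word of length $n$ on $M=\{1,\dots,m\}$ (naturally ordered) is a sequence $w=w_1\cdots w_n$ with $w_i\in M$. For a word $abc$ on $\{1,2,3\}$, a word $w$ contains the generalized pattern $a-bc$ if there are indices $1\le i<j<n$ such that $(w_i,w_j,w_{j+1})$ is order-isomorphic to $(a,b,c)$ (all pairwise comparisons $<,=,>$ agree); otherwise $w$ avoids $a-bc$. Concretely, $w$ contains $1-12$ iff there exist $i<j<n$ with $w_i=w_j<w_{j+1}$, and contains $2-21$ iff there exist $i<j<n$ with $w_i=w_j>w_{j+1}$. -}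

module Defs where

open import Data.Nat using (ℕ; _≤_; _<_)
open import Data.List using (List; []; _∷_; _++_; length)
open import Data.List.Relation.Unary.All using (All)
open import Data.List.Relation.Unary.Unique.Propositional using (Unique)
open import Data.List.Membership.Propositional using (_∈_)
open import Data.Product using (Σ; _×_; ∃-syntax)
open import Function.Bundles using (_⇔_)
open import Relation.Binary.PropositionalEquality using (_≡_)

IsWord : ℕ → ℕ → List ℕ → Set
IsWord m n w = (length w ≡ n) × All (λ x → (1 ≤ x) × (x ≤ m)) w

-- w contains 1-12: there are positions i < j < n with w_i = w_j < w_{j+1},
-- i.e. w = u ++ a ∷ (v ++ b ∷ c ∷ t) with a = b < c.
Contains-1-12 : List ℕ → Set
Contains-1-12 w = ∃[ u ] ∃[ v ] ∃[ t ] ∃[ a ] ∃[ b ] ∃[ c ]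
  ((w ≡ u ++ a ∷ (v ++ b ∷ c ∷ t)) × (a ≡ b) × (b < c))

Contains-2-21 : List ℕ → Set
Contains-2-21 w = ∃[ u ] ∃[ v ] ∃[ t ] ∃[ a ] ∃[ b ] ∃[ c ]
  ((w ≡ u ++ a ∷ (v ++ b ∷ c ∷ t)) × (a ≡ b) × (c < b))

AvoidsT : List ℕ → Set
AvoidsT w = (Contains-1-12 w → Data.Empty.⊥) × (Contains-2-21 w → Data.Empty.⊥)
  where import Data.Empty

LettersExactly : ℕ → List ℕ → Set
LettersExactly k w = ∀ x → (x ∈ w) ⇔ ((1 ≤ x) × (x ≤ k))

Alpha : ℕ → ℕ → ℕ → List ℕ → Set
Alpha m n k w = IsWord m n w × AvoidsT w × LettersExactly k w

-- "the number of lists satisfying P is N": there is a duplicate-free list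
-- enumerating exactly the lists satisfying P, and it has length N.
NumberOf : (List ℕ → Set) → ℕ → Set
NumberOf P N = Σ (List (List ℕ)) λ ws →
  Unique ws × (∀ w → (w ∈ ws) ⇔ P w) × (length ws ≡ N)

module Submission where

-- A word w avoids both patterns iff every letter that
-- has already occurred is followed by itself (w "stalls" on repeats).  Hence
-- an avoider is either a word p with distinct letters, or p followed by a
-- non-empty run x x … x of a letter x already in p.
--
-- With letter set exactly {1,…,k} the distinct-letter part p is a
-- permutation of {1,…,k}.  Permutations are enumerated by inserting the
-- largest letter k+1 into the permutations of {1,…,k} (k! of them).  So for
-- n = k the avoiders are the k! permutations, for n > k they are the words
-- p ++ x^(n-k) with x ∈ p, k·k! of them, and for k > m there are none since
-- the letter k does not fit in the alphabet.  Both enumerations are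
-- concatenations of fibres over the permutations; a "product rule" shows they
-- are duplicate-free of the expected length.

open import Defs
open import Data.Nat using (ℕ; suc; _+_; _*_; _!; _≤_; _<_; z≤n; s≤s; s≤s⁻¹; _≟_)
open import Data.Nat.Properties
  using (≤-refl; ≤-trans; <⇒≱; <-irrefl; ≤∧≢⇒<; m≤n⇒m≤1+n; n<1+n; <-cmp;
         *-comm; +-suc; +-cancelˡ-≡; suc-injective; m≤n⇒∃[o]m+o≡n; m+1+n≢m)
open import Data.List using (List; []; _∷_; _++_; [_]; length; map; replicate; take; concatMap; filter)
open import Data.List.Properties
  using (length-++; length-++-sucʳ; length-map; length-replicate; ++-assoc; ++-cancelˡ;
         ∷-injective; ∷-injectiveˡ; ++-identityʳ; ∷-injectiveʳ; filter-++; filter-all; filter-reject)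
open import Data.List.Relation.Unary.All as All using (All; []; _∷_)
open import Data.List.Relation.Unary.Any as Any using (here; there)
open import Data.List.Relation.Unary.AllPairs using ([]; _∷_)
open import Data.List.Relation.Unary.Unique.Propositional using (Unique)
open import Data.List.Relation.Unary.Unique.Propositional.Properties using (map⁺; ++⁺)
open import Data.List.Membership.Propositional using (_∈_; _∉_; find)
open import Data.List.Membership.DecPropositional _≟_ using (_∈?_)
open import Data.List.Membership.Propositional.Properties
  using (∈-map⁺; ∈-map⁻; ∈-++⁺ˡ; ∈-++⁺ʳ; ∈-++⁻; ∈-∃++; ∈-concatMap⁺; ∈-concatMap⁻)
open import Data.List.Relation.Binary.Permutation.Propositional using (_↭_; ↭-sym; ↭⇒↭ₛ)
open import Data.List.Relation.Binary.Permutation.Propositional.Properties using (∈-resp-↭; shift)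
import Data.List.Relation.Binary.Permutation.Setoid.Properties as SetoidPerm
open import Data.Product using (_×_; ∃₂; ∃-syntax; _,_; proj₁; proj₂)
open import Data.Sum using (_⊎_; inj₁; inj₂)
open import Data.Empty using (⊥-elim)
open import Function.Base using (_∘_)
open import Function.Bundles using (_⇔_; mk⇔; Equivalence)
open import Function.Construct.Composition using (_⇔-∘_)
open import Function.Construct.Symmetry using (⇔-sym)
open import Relation.Nullary using (¬_; Dec; yes; no; ¬?)
open import Relation.Binary using (tri<; tri≈; tri>)
open import Relation.Binary.PropositionalEquality
  using (_≡_; _≢_; refl; sym; trans; cong; cong₂; subst; setoid; module ≡-Reasoning)

-- The product rule for concatenations of fibres.

module ProductRule {A B : Set} (f : A → List B) where

  ∈-concatMap-intro : ∀ {x xs} {w : B} → x ∈ xs → w ∈ f x → w ∈ concatMap f xs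
  ∈-concatMap-intro x∈ w∈ = ∈-concatMap⁺ f (Any.map (λ { refl → w∈ }) x∈)

  ∈-concatMap-elim : ∀ xs {w : B} → w ∈ concatMap f xs → ∃[ x ] (x ∈ xs × w ∈ f x)
  ∈-concatMap-elim xs w∈ = find (∈-concatMap⁻ f {xs} w∈)

  length-concatMap : ∀ {c} xs → All (λ x → length (f x) ≡ c) xs →
                     length (concatMap f xs) ≡ length xs * c
  length-concatMap []       []          = refl
  length-concatMap (x ∷ xs) (fx≡c ∷ rest) =
    trans (length-++ (f x)) (cong₂ _+_ fx≡c (length-concatMap xs rest))

  -- If every element of the fibre over x remembers x (via `back`), distinct
  -- base points have disjoint fibres, so duplicate-freeness is inherited.
  unique-concatMap : (back : B → A) → ∀ {xs} → Unique xs →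
                     All (λ x → ∀ {w} → w ∈ f x → back w ≡ x) xs →
                     All (Unique ∘ f) xs → Unique (concatMap f xs)
  unique-concatMap back {[]}     _              _              _            = []
  unique-concatMap back {x ∷ xs} (x∉xs ∷ uxs) (backx ∷ backs) (ufx ∷ ufs) =
    ++⁺ ufx (unique-concatMap back uxs backs ufs) disjoint
    where
    disjoint : ∀ {w} → ¬ (w ∈ f x × w ∈ concatMap f xs)
    disjoint (w∈fx , w∈rest) with ∈-concatMap-elim xs w∈rest
    ... | y , y∈xs , w∈fy =
      All.lookup x∉xs y∈xs (trans (sym (backx w∈fx)) (All.lookup backs y∈xs w∈fy))

open ProductRule

module _ {A : Set} where

  inserts : A → List A → List (List A)
  inserts x []      = [ [ x ] ]
  inserts x (y ∷ p) = (x ∷ y ∷ p) ∷ map (y ∷_) (inserts x p)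

  ∈-inserts⁺ : ∀ x u v → u ++ x ∷ v ∈ inserts x (u ++ v)
  ∈-inserts⁺ x []      []      = here refl
  ∈-inserts⁺ x []      (y ∷ v) = here refl
  ∈-inserts⁺ x (y ∷ u) v       = there (∈-map⁺ (y ∷_) (∈-inserts⁺ x u v))

  ∈-inserts⁻ : ∀ x p {w} → w ∈ inserts x p → ∃₂ λ u v → p ≡ u ++ v × w ≡ u ++ x ∷ v
  ∈-inserts⁻ x []      (here refl) = [] , [] , refl , refl
  ∈-inserts⁻ x (y ∷ p) (here refl) = [] , y ∷ p , refl , refl
  ∈-inserts⁻ x (y ∷ p) (there w∈) with ∈-map⁻ (y ∷_) w∈
  ... | w′ , w′∈ , refl with ∈-inserts⁻ x p w′∈
  ...   | u , v , refl , refl = y ∷ u , v , refl , refl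

  length-inserts : ∀ x p → length (inserts x p) ≡ suc (length p)
  length-inserts x []      = refl
  length-inserts x (y ∷ p) = cong suc (trans (length-map (y ∷_) (inserts x p)) (length-inserts x p))

  unique-inserts : ∀ x p → x ∉ p → Unique (inserts x p)
  unique-inserts x []      _    = [] ∷ []
  unique-inserts x (y ∷ p) x∉yp =
    All.tabulate head≢ ∷ map⁺ ∷-injectiveʳ (unique-inserts x p (x∉yp ∘ there))
    where
    head≢ : ∀ {w} → w ∈ map (y ∷_) (inserts x p) → x ∷ y ∷ p ≢ w
    head≢ w∈ refl with ∈-map⁻ (y ∷_) w∈
    ... | _ , _ , eq = x∉yp (here (∷-injectiveˡ eq))

differs? : ∀ x y → Dec (x ≢ y)
differs? x y = ¬? (x ≟ y)

erase : ℕ → List ℕ → List ℕ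
erase x = filter (differs? x)

erase-inserts : ∀ x p {w} → x ∉ p → w ∈ inserts x p → erase x w ≡ p
erase-inserts x p x∉p w∈ with ∈-inserts⁻ x p w∈
... | u , v , refl , refl = begin
  erase x (u ++ x ∷ v)         ≡⟨ filter-++ (differs? x) u (x ∷ v) ⟩
  erase x u ++ erase x (x ∷ v) ≡⟨ cong (erase x u ++_) (filter-reject (differs? x) (λ x≢x → x≢x refl)) ⟩
  erase x u ++ erase x v       ≡⟨ sym (filter-++ (differs? x) u v) ⟩
  erase x (u ++ v)             ≡⟨ filter-all (differs? x) (All.tabulate (λ y∈ x≡y → x∉p (subst (_∈ u ++ v) (sym x≡y) y∈))) ⟩
  u ++ v                       ∎
  where open ≡-Reasoning

-- Permutations of {1,…,k}.

Perm : ℕ → List ℕ → Set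
Perm k w = Unique w × LettersExactly k w

unique-resp-↭ : ∀ {xs ys : List ℕ} → xs ↭ ys → Unique xs → Unique ys
unique-resp-↭ p = SetoidPerm.Unique-resp-↭ (setoid ℕ) (↭⇒↭ₛ p)

Perm-resp-↭ : ∀ {k w w′} → w ↭ w′ → Perm k w → Perm k w′
Perm-resp-↭ σ (uw , lw) =
  unique-resp-↭ σ uw ,
  λ z → mk⇔ (Equivalence.to (lw z) ∘ ∈-resp-↭ (↭-sym σ)) (∈-resp-↭ σ ∘ Equivalence.from (lw z))

top-fresh : ∀ {k p} → LettersExactly k p → suc k ∉ p
top-fresh {k} lp sk∈p = <⇒≱ (n<1+n k) (proj₂ (Equivalence.to (lp (suc k)) sk∈p))

Perm-top⁻ : ∀ {k p} → Perm (suc k) (suc k ∷ p) → Perm k p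
Perm-top⁻ {k} {p} (sk∉p ∷ up , lw) = up , λ z → mk⇔ (to z) (from z)
  where
  to : ∀ z → z ∈ p → 1 ≤ z × z ≤ k
  to z z∈p with Equivalence.to (lw z) (there z∈p)
  ... | 1≤z , z≤sk = 1≤z , s≤s⁻¹ (≤∧≢⇒< z≤sk (λ z≡sk → All.lookup sk∉p z∈p (sym z≡sk)))
  from : ∀ z → 1 ≤ z × z ≤ k → z ∈ p
  from z (1≤z , z≤k) with Equivalence.from (lw z) (1≤z , m≤n⇒m≤1+n z≤k)
  ... | here refl = ⊥-elim (<⇒≱ (n<1+n k) z≤k)
  ... | there z∈p = z∈p

Perm-top⁺ : ∀ {k p} → Perm k p → Perm (suc k) (suc k ∷ p)
Perm-top⁺ {k} {p} (up , lp) =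
  All.tabulate (λ z∈p sk≡z → top-fresh lp (subst (_∈ p) (sym sk≡z) z∈p)) ∷ up ,
  λ z → mk⇔ (to z) (from z)
  where
  to : ∀ z → z ∈ suc k ∷ p → 1 ≤ z × z ≤ suc k
  to z (here refl) = s≤s z≤n , ≤-refl
  to z (there z∈p) with Equivalence.to (lp z) z∈p
  ... | 1≤z , z≤k = 1≤z , m≤n⇒m≤1+n z≤k
  from : ∀ z → 1 ≤ z × z ≤ suc k → z ∈ suc k ∷ p
  from z (1≤z , z≤sk) with z ≟ suc k
  ... | yes refl = here refl
  ... | no z≢sk  = there (Equivalence.from (lp z) (1≤z , s≤s⁻¹ (≤∧≢⇒< z≤sk z≢sk)))

Perm-insert⁻ : ∀ {k} u v → Perm (suc k) (u ++ suc k ∷ v) → Perm k (u ++ v)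
Perm-insert⁻ {k} u v = Perm-top⁻ ∘ Perm-resp-↭ (shift (suc k) u v)

Perm-insert⁺ : ∀ {k} u v → Perm k (u ++ v) → Perm (suc k) (u ++ suc k ∷ v)
Perm-insert⁺ {k} u v = Perm-resp-↭ (↭-sym (shift (suc k) u v)) ∘ Perm-top⁺

perms : ℕ → List (List ℕ)
perms 0       = [ [] ]
perms (suc k) = concatMap (inserts (suc k)) (perms k)

∈-perms⁻ : ∀ k {w} → w ∈ perms k → Perm k w × length w ≡ k
∈-perms⁻ 0 (here refl) = ([] , λ z → mk⇔ (λ ()) (λ (1≤z , z≤0) → ⊥-elim (<⇒≱ 1≤z z≤0))) , refl
∈-perms⁻ (suc k) w∈ with ∈-concatMap-elim (inserts (suc k)) (perms k) w∈
... | p , p∈ , w∈ins with ∈-inserts⁻ (suc k) p w∈ins | ∈-perms⁻ k p∈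
...   | u , v , refl , refl | perm , len =
  Perm-insert⁺ u v perm , trans (length-++-sucʳ u (suc k) v) (cong suc len)

∈-perms⁺ : ∀ k {w} → Perm k w → w ∈ perms k
∈-perms⁺ 0       {[]}    _        = here refl
∈-perms⁺ 0       {z ∷ w} (_ , lw) with Equivalence.to (lw z) (here refl)
... | 1≤z , z≤0 = ⊥-elim (<⇒≱ 1≤z z≤0)
∈-perms⁺ (suc k) perm@(_ , lw) with ∈-∃++ (Equivalence.from (lw (suc k)) (s≤s z≤n , ≤-refl))
... | u , v , refl =
  ∈-concatMap-intro (inserts (suc k)) (∈-perms⁺ k (Perm-insert⁻ u v perm)) (∈-inserts⁺ (suc k) u v)

-- without repetition (the fibres are disjoint: erasing k+1 recovers the base),
unique-perms : ∀ k → Unique (perms k)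
unique-perms 0       = [] ∷ []
unique-perms (suc k) =
  unique-concatMap (inserts (suc k)) (erase (suc k)) (unique-perms k)
    (All.tabulate λ p∈ → erase-inserts (suc k) _ (fresh p∈))
    (All.tabulate λ p∈ → unique-inserts (suc k) _ (fresh p∈))
  where
  fresh : ∀ {p} → p ∈ perms k → suc k ∉ p
  fresh p∈ = top-fresh (proj₂ (proj₁ (∈-perms⁻ k p∈)))

length-perms : ∀ k → length (perms k) ≡ k !
length-perms 0       = refl
length-perms (suc k) = begin
  length (perms (suc k))   ≡⟨ length-concatMap (inserts (suc k)) (perms k) (All.tabulate fibre-size) ⟩
  length (perms k) * suc k ≡⟨ cong (_* suc k) (length-perms k) ⟩
  k ! * suc k              ≡⟨ *-comm (k !) (suc k) ⟩
  suc k !                  ∎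
  where
  open ≡-Reasoning
  fibre-size : ∀ {p} → p ∈ perms k → length (inserts (suc k) p) ≡ suc k
  fibre-size {p} p∈ = trans (length-inserts (suc k) p) (cong suc (proj₂ (∈-perms⁻ k p∈)))

-- Structure of the words avoiding 1-12 and 2-21.

StallsOnRepeats : List ℕ → Set
StallsOnRepeats w = ∀ s a c t → w ≡ s ++ a ∷ c ∷ t → a ∈ s → c ≡ a

regroup : ∀ u v t (a b c : ℕ) → u ++ a ∷ (v ++ b ∷ c ∷ t) ≡ (u ++ a ∷ v) ++ b ∷ c ∷ t
regroup u v t a b c = sym (++-assoc u (a ∷ v) (b ∷ c ∷ t))

-- After a repeated letter a the next letter c can be neither larger
-- (pattern 1-12) nor smaller (pattern 2-21).
avoids⇒stalls : ∀ {w} → AvoidsT w → StallsOnRepeats w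
avoids⇒stalls (no-1-12 , no-2-21) s a c t refl a∈s with ∈-∃++ a∈s
... | u , v , refl with <-cmp c a
...   | tri< c<a _ _ = ⊥-elim (no-2-21 (u , v , t , a , a , c , sym (regroup u v t a a c) , refl , c<a))
...   | tri≈ _ c≡a _ = c≡a
...   | tri> _ _ a<c = ⊥-elim (no-1-12 (u , v , t , a , a , c , sym (regroup u v t a a c) , refl , a<c))

-- Conversely, an occurrence of either pattern is a repeat that does not stall.
stalls⇒avoids : ∀ {w} → StallsOnRepeats w → AvoidsT w
stalls⇒avoids st =
  (λ { (u , v , t , a , .a , c , w≡ , refl , a<c) → <-irrefl (sym (repeat u v t a c w≡)) a<c }) ,
  (λ { (u , v , t , a , .a , c , w≡ , refl , c<a) → <-irrefl (repeat u v t a c w≡) c<a })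
  where
  repeat : ∀ u v t a c → _ ≡ u ++ a ∷ (v ++ a ∷ c ∷ t) → c ≡ a
  repeat u v t a c w≡ = st (u ++ a ∷ v) a c t (trans w≡ (regroup u v t a a c)) (∈-++⁺ʳ u (here refl))

data Shape : List ℕ → Set where
  distinct : ∀ {p} → Unique p → Shape p
  stutter  : ∀ {p x} → Unique p → x ∈ p → ∀ r → Shape (p ++ replicate (suc r) x)

∈-replicate⁻ : ∀ {A : Set} n {x z : A} → z ∈ replicate n x → z ≡ x
∈-replicate⁻ (suc n) (here z≡x)  = z≡x
∈-replicate⁻ (suc n) (there z∈) = ∈-replicate⁻ n z∈

stalls-run : ∀ s y w → y ∈ s → StallsOnRepeats (s ++ y ∷ w) → w ≡ replicate (length w) y
stalls-run s y []      _   _  = refl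
stalls-run s y (c ∷ w) y∈s st with st s y c w refl y∈s
... | refl = cong (y ∷_) (stalls-run (s ++ [ y ]) y w (∈-++⁺ˡ y∈s) st′)
  where
  st′ : StallsOnRepeats ((s ++ [ y ]) ++ y ∷ w)
  st′ = subst StallsOnRepeats (sym (++-assoc s [ y ] (y ∷ w))) st

-- Scanning a stalling word s ++ w whose already read part s has distinct
-- letters: either no letter repeats, or the first repeat starts the run.
stalls-shape : ∀ s w → Unique s → StallsOnRepeats (s ++ w) → Shape (s ++ w)
stalls-shape s []      us _  = subst Shape (sym (++-identityʳ s)) (distinct us)
stalls-shape s (y ∷ w) us st with y ∈? s
... | yes y∈s = subst (λ t → Shape (s ++ y ∷ t)) (sym (stalls-run s y w y∈s st)) (stutter us y∈s (length w))
... | no  y∉s = subst Shape (++-assoc s [ y ] w) (stalls-shape (s ++ [ y ]) w us′ st′)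
  where
  us′ : Unique (s ++ [ y ])
  us′ = ++⁺ us ([] ∷ []) (λ { (y∈s , here refl) → y∉s y∈s })
  st′ : StallsOnRepeats ((s ++ [ y ]) ++ w)
  st′ = subst StallsOnRepeats (sym (++-assoc s [ y ] w)) st

++-split : ∀ {A : Set} (p q R z : List A) → p ++ R ≡ q ++ z →
           (∃[ d ] (q ≡ p ++ d × R ≡ d ++ z)) ⊎ (∃₂ λ e es → p ≡ q ++ e ∷ es × z ≡ e ∷ es ++ R)
++-split []      q       R z eq = inj₁ (q , refl , eq)
++-split (x ∷ p) []      R z eq = inj₂ (x , p , refl , sym eq)
++-split (x ∷ p) (y ∷ q) R z eq with ∷-injective eq
... | refl , eq′ with ++-split p q R z eq′
...   | inj₁ (d , refl , R≡)       = inj₁ (d , refl , R≡)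
...   | inj₂ (e , es , refl , z≡) = inj₂ (e , es , refl , z≡)

unique-later : ∀ {A : Set} s {a : A} {t} → Unique (s ++ a ∷ t) → a ∉ s
unique-later (y ∷ s) (y∉ ∷ _) (here refl) = All.lookup y∉ (∈-++⁺ʳ s (here refl)) refl
unique-later (y ∷ s) (_ ∷ u)  (there a∈s) = unique-later s u a∈s

-- Conversely every shape stalls: a repeated letter must lie in the run.
shape⇒stalls : ∀ {w} → Shape w → StallsOnRepeats w
shape⇒stalls (distinct up) s a c t refl a∈s = ⊥-elim (unique-later s up a∈s)
shape⇒stalls (stutter {p} {x} up x∈p r) s a c t w≡ a∈s
  with ++-split p s (replicate (suc r) x) (a ∷ c ∷ t) w≡
... | inj₁ (d , _ , run≡) = trans (in-run (there (here refl))) (sym (in-run (here refl)))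
  where
  in-run : ∀ {z} → z ∈ a ∷ c ∷ t → z ≡ x
  in-run z∈ = ∈-replicate⁻ (suc r) (subst (_ ∈_) (sym run≡) (∈-++⁺ʳ d z∈))
... | inj₂ (e , es , p≡ , a∷c∷t≡) with ∷-injectiveˡ a∷c∷t≡
...   | refl = ⊥-elim (unique-later s (subst Unique p≡ up) a∈s)

avoids⇔shape : ∀ w → AvoidsT w ⇔ Shape w
avoids⇔shape w = mk⇔ (stalls-shape [] w [] ∘ avoids⇒stalls) (stalls⇒avoids ∘ shape⇒stalls)

-- Avoiders with letter set exactly {1,…,k}.

stutter-letters : ∀ {p : List ℕ} {x : ℕ} n {z} → x ∈ p → z ∈ p ++ replicate n x ⇔ z ∈ p
stutter-letters {p} {x} n x∈p = mk⇔ from-word ∈-++⁺ˡ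
  where
  from-word : ∀ {z} → z ∈ p ++ replicate n x → z ∈ p
  from-word z∈ with ∈-++⁻ p z∈
  ... | inj₁ z∈p   = z∈p
  ... | inj₂ z∈run = subst (_∈ p) (sym (∈-replicate⁻ n z∈run)) x∈p

stutter-perm : ∀ {k p x} n → Unique p → x ∈ p → LettersExactly k (p ++ replicate n x) → Perm k p
stutter-perm n up x∈p lw = up , λ z → lw z ⇔-∘ ⇔-sym (stutter-letters n x∈p)

perm-length : ∀ {k p} → Perm k p → length p ≡ k
perm-length {k} perm = proj₂ (∈-perms⁻ k (∈-perms⁺ k perm))

stutter-length : ∀ {k p} n {x : ℕ} → Perm k p → length (p ++ replicate n x) ≡ k + n
stutter-length {p = p} n perm =
  trans (length-++ p) (cong₂ _+_ (perm-length perm) (length-replicate n))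

letters-in-alphabet : ∀ {m k w} → k ≤ m → LettersExactly k w → All (λ x → (1 ≤ x) × (x ≤ m)) w
letters-in-alphabet k≤m lw =
  All.tabulate λ {z} z∈ → let (1≤z , z≤k) = Equivalence.to (lw z) z∈ in 1≤z , ≤-trans z≤k k≤m

∈-perms⇔alpha : ∀ {m k} → k ≤ m → ∀ w → w ∈ perms k ⇔ Alpha m k k w
∈-perms⇔alpha {m} {k} k≤m w = mk⇔ sound complete
  where
  sound : w ∈ perms k → Alpha m k k w
  sound w∈ with ∈-perms⁻ k w∈
  ... | (uw , lw) , len =
    (len , letters-in-alphabet k≤m lw) , Equivalence.from (avoids⇔shape w) (distinct uw) , lw
  complete : Alpha m k k w → w ∈ perms k
  complete ((len , _) , avoids , lw) with Equivalence.to (avoids⇔shape w) avoids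
  ... | distinct uw = ∈-perms⁺ k (uw , lw)
  ... | stutter up x∈p r =
    ⊥-elim (m+1+n≢m k (trans (sym (stutter-length (suc r) (stutter-perm (suc r) up x∈p lw))) len))

stutters : ℕ → List ℕ → List (List ℕ)
stutters r p = map (λ x → p ++ replicate (suc r) x) p

stutterings : ℕ → ℕ → List (List ℕ)
stutterings k r = concatMap (stutters r) (perms k)

∈-stutterings⇔alpha : ∀ {m k} → k ≤ m → ∀ r w → w ∈ stutterings k r ⇔ Alpha m (k + suc r) k w
∈-stutterings⇔alpha {m} {k} k≤m r w = mk⇔ sound complete
  where
  sound : w ∈ stutterings k r → Alpha m (k + suc r) k w
  sound w∈ with ∈-concatMap-elim (stutters r) (perms k) w∈
  ... | p , p∈ , w∈stutters with ∈-map⁻ (λ x → p ++ replicate (suc r) x) w∈stutters | ∈-perms⁻ k p∈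
  ...   | x , x∈p , refl | (up , lp) , _ =
    (stutter-length (suc r) (up , lp) , letters-in-alphabet k≤m lw) ,
    Equivalence.from (avoids⇔shape w) (stutter up x∈p r) , lw
    where
    lw : LettersExactly k (p ++ replicate (suc r) x)
    lw z = lp z ⇔-∘ stutter-letters (suc r) x∈p
  complete : Alpha m (k + suc r) k w → w ∈ stutterings k r
  complete ((len , _) , avoids , lw) with Equivalence.to (avoids⇔shape w) avoids
  ... | distinct uw =
    ⊥-elim (m+1+n≢m k (trans (sym len) (perm-length (uw , lw))))
  ... | stutter {p} {x} up x∈p r′ =
    ∈-concatMap-intro (stutters r) p∈ (subst (λ j → p ++ replicate (suc j) x ∈ stutters r p) r≡r′
                                             (∈-map⁺ (λ y → p ++ replicate (suc r) y) x∈p))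
    where
    perm : Perm k p
    perm = stutter-perm (suc r′) up x∈p lw
    p∈ : p ∈ perms k
    p∈ = ∈-perms⁺ k perm
    r≡r′ : r ≡ r′
    r≡r′ = suc-injective (+-cancelˡ-≡ k (suc r) (suc r′) (trans (sym len) (stutter-length (suc r′) perm)))

-- A stutter remembers its permutation as its first k letters.
take-++-length : ∀ (p s : List ℕ) → take (length p) (p ++ s) ≡ p
take-++-length []      s = refl
take-++-length (x ∷ p) s = cong (x ∷_) (take-++-length p s)

unique-stutterings : ∀ k r → Unique (stutterings k r)
unique-stutterings k r =
  unique-concatMap (stutters r) (take k) (unique-perms k)
    (All.tabulate remembers)
    (All.tabulate λ p∈ → map⁺ run-injective (proj₁ (proj₁ (∈-perms⁻ k p∈))))
  where
  remembers : ∀ {p} → p ∈ perms k → ∀ {w} → w ∈ stutters r p → take k w ≡ p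
  remembers {p} p∈ w∈ with ∈-map⁻ (λ x → p ++ replicate (suc r) x) w∈
  ... | x , _ , refl =
    subst (λ j → take j (p ++ replicate (suc r) x) ≡ p) (proj₂ (∈-perms⁻ k p∈)) (take-++-length p _)
  run-injective : ∀ {p} {x y : ℕ} → p ++ replicate (suc r) x ≡ p ++ replicate (suc r) y → x ≡ y
  run-injective {p} eq = ∷-injectiveˡ (++-cancelˡ p _ _ eq)

length-stutterings : ∀ k r → length (stutterings k r) ≡ k * k !
length-stutterings k r = begin
  length (stutterings k r) ≡⟨ length-concatMap (stutters r) (perms k) (All.tabulate fibre-size) ⟩
  length (perms k) * k     ≡⟨ cong (_* k) (length-perms k) ⟩
  k ! * k                  ≡⟨ *-comm (k !) k ⟩
  k * k !                  ∎
  where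
  open ≡-Reasoning
  fibre-size : ∀ {p} → p ∈ perms k → length (stutters r p) ≡ k
  fibre-size {p} p∈ = trans (length-map _ p) (proj₂ (∈-perms⁻ k p∈))

count-permutations : ∀ m k → k ≤ m → NumberOf (Alpha m k k) (k !)
count-permutations m k k≤m = perms k , unique-perms k , ∈-perms⇔alpha k≤m , length-perms k

count-stutterings : ∀ m k r → k ≤ m → NumberOf (Alpha m (k + suc r) k) (k * k !)
count-stutterings m k r k≤m =
  stutterings k r , unique-stutterings k r , ∈-stutterings⇔alpha k≤m r , length-stutterings k r

no-large-alphabet : ∀ {m n k w} → m < k → ¬ Alpha m n k w
no-large-alphabet {k = k} m<k ((_ , in-alphabet) , _ , lw) =
  <⇒≱ m<k (proj₂ (All.lookup in-alphabet (Equivalence.from (lw k) (≤-trans (s≤s z≤n) m<k , ≤-refl))))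

count-empty : ∀ m n k → m < k → NumberOf (Alpha m n k) 0
count-empty m n k m<k = [] , [] , (λ w → mk⇔ (λ ()) (⊥-elim ∘ no-large-alphabet m<k)) , refl

mainTheorem1 : (m : ℕ) → 1 ≤ m → (n k : ℕ) →
    ((k ≤ m) → (k < n) → NumberOf (Alpha m n k) (k * (k !)))
    × ((k ≤ m) → (k ≡ n) → NumberOf (Alpha m n k) (n !))
    × ((m < k) → NumberOf (Alpha m n k) 0)
mainTheorem1 m _ n k = longer , same-length , count-empty m n k
  where
  longer : k ≤ m → k < n → NumberOf (Alpha m n k) (k * k !)
  longer k≤m k<n with m≤n⇒∃[o]m+o≡n k<n
  ... | r , refl = subst (λ j → NumberOf (Alpha m j k) (k * k !)) (+-suc k r) (count-stutterings m k r k≤m)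
  same-length : k ≤ m → k ≡ n → NumberOf (Alpha m n k) (n !)
  same-length k≤m refl = count-permutations m k k≤m
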